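{- Every matroid complex is strongly shellable.
   Context: A simplicial complex is a finite family of subsets of a vertex set closed under taking subsets; $\mathcal{F}(\Delta)$ is its set of facets. A matroid complex is a simplicial complex $\Delta$ such that for any two distinct facets $F,G$ and any $i\in F\setminus G$ there exists $j\in G\setminus F$ with $(F\setminus\{i\})\cup\{j\}\in\Delta$. A linear order $F_1,\dots,F_t$ of $\mathcal{F}(\Delta)$ is a strong shelling order if for every $1\le i<j\le t$ there exists $k$ with $1\le k<j$ such that $|F_j\setminus F_k|=1$, $F_j\setminus F_k\subseteq F_j\setminus F_i$, and $F_k\setminus F_j\subseteq F_i$; $\Delta$ is strongly shellable if such an order exists. -}

module Defs where

open import Data.Nat using (ℕ; _<_)
open import Data.Fin using (Fin; toℕ)
open import Data.Fin.Subset using (Subset; _∈_; _∉_; _⊆_; _∪_; _─_; _-_; ⁅_⁆; ∣_∣)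
open import Data.List using (List; length; lookup)
import Data.List.Membership.Propositional as LMem
open import Data.List.Relation.Unary.Unique.Propositional using (Unique)
open import Data.Product using (Σ; ∃; _×_; _,_)
open import Relation.Binary.PropositionalEquality using (_≡_; _≢_)
open import Relation.Nullary using (¬_; Dec)
open import Function.Bundles using (_⇔_)

record SimplicialComplex (n : ℕ) : Set₁ where
  field
    face   : Subset n → Set
    closed : ∀ {F G} → face G → F ⊆ G → face F
    -- a finite family of subsets: membership is decidable
    decide : ∀ F → Dec (face F)
open SimplicialComplex public

IsFacet : ∀ {n} → SimplicialComplex n → Subset n → Set
IsFacet Δ F = face Δ F × (∀ G → face Δ G → F ⊆ G → G ≡ F)

IsMatroidComplex : ∀ {n} → SimplicialComplex n → Set
IsMatroidComplex {n} Δ =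
  ∀ F G → IsFacet Δ F → IsFacet Δ G → F ≢ G →
  ∀ (i : Fin n) → i ∈ F → i ∉ G →
  Σ (Fin n) λ j → j ∈ G × j ∉ F × face Δ ((F - i) ∪ ⁅ j ⁆)

IsFacetOrder : ∀ {n} → SimplicialComplex n → List (Subset n) → Set
IsFacetOrder Δ L = Unique L × (∀ F → (F LMem.∈ L) ⇔ IsFacet Δ F)

IsStrongShellingOrder : ∀ {n} → SimplicialComplex n → List (Subset n) → Set
IsStrongShellingOrder Δ L =
  IsFacetOrder Δ L ×
  (∀ (i j : Fin (length L)) → toℕ i < toℕ j →
     Σ (Fin (length L)) λ k → toℕ k < toℕ j ×
       (∣ lookup L j ─ lookup L k ∣ ≡ 1) ×
       ((lookup L j ─ lookup L k) ⊆ (lookup L j ─ lookup L i)) ×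
       ((lookup L k ─ lookup L j) ⊆ lookup L i))

IsStronglyShellable : ∀ {n} → SimplicialComplex n → Set
IsStronglyShellable Δ = ∃ λ L → IsStrongShellingOrder Δ L

-- Order the facets lexicographically.  If F_i precedes F_j, the first vertex x
-- where they differ lies in F_j ∖ F_i, and the exchange axiom gives y ∈ F_i ∖ F_j
-- such that H = (F_j ∖ {x}) ∪ {y} is a face.  Repeated exchanges show that all
-- facets of a matroid complex have the same size, so H is a facet; as y comes
-- after x, H precedes F_j.  Since H ∖ F_j = {y} ⊆ F_i and F_j ∖ H = {x} ⊆ F_j ∖ F_i,
-- H is the facet F_k required by the strong shelling condition.

module Submission where

open import Defs
open import Data.Bool as Bool using ()
import Data.Bool.Properties as Bool
open import Data.Fin using (Fin; zero; suc; toℕ; _≟_)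
open import Data.Fin.Properties using (any?; <-cmp)
open import Data.Fin.Subset
  using (Subset; inside; outside; _∈_; _∉_; _⊆_; _⊂_; _∪_; _─_; _-_; ⁅_⁆; ∣_∣)
open import Data.Fin.Subset.Properties
  using (_∈?_; drop-there; ∣p∣≤n; x∈⁅x⁆; x∈⁅y⁆⇒x≡y; x∉⁅y⁆⇒x≢y; ∣⁅x⁆∣≡1; ⊆-antisym; ⊆-⊂-trans;
         p⊆q⇒∣p∣≤∣q∣; p⊂q⇒∣p∣<∣q∣; p⊆p∪q; q⊆p∪q; x∈p∪q⁻; ∪-identityʳ; p─q⊆p; p─⊥≡p;
         x∈p∧x∉q⇒x∈p─q; x∈p∧x≢y⇒x∈p-y)
open import Data.List using (List; []; _∷_; [_]; length; lookup; map; _++_; filter)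
open import Data.List.Membership.Propositional using () renaming (_∈_ to _∈ₗ_)
open import Data.List.Membership.Propositional.Properties
  using (∈-lookup; ∈-filter⁺; ∈-filter⁻; ∈-++⁺ˡ; ∈-++⁺ʳ; ∈-map⁺)
open import Data.List.Relation.Unary.All using ([]; universal) renaming (lookup to All-lookup)
import Data.List.Relation.Unary.All.Properties as All
open import Data.List.Relation.Unary.AllPairs using (AllPairs; []; _∷_) renaming (map to AllPairs-map)
import Data.List.Relation.Unary.AllPairs.Properties as AllPairs
open import Data.List.Relation.Unary.Any using (here; there; index)
open import Data.List.Relation.Unary.Any.Properties using (lookup-index)
open import Data.Nat using (ℕ; zero; suc; _+_; _≤_; _<_; s≤s)
open import Data.Nat.Properties
  using (≤-reflexive; ≤-trans; <-≤-trans; ≤-pred; <⇒≱; +-suc; m≤m+n; n<1+n; module ≤-Reasoning)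
open import Data.Product using (∃; _×_; _,_; proj₂)
open import Data.Sum using (_⊎_; inj₁; inj₂)
open import Data.Vec using ([]; _∷_; here; there)
open import Data.Vec.Relation.Binary.Lex.Strict as Lex using (Lex-<; this; next)
open import Function using (_∘_; id)
open import Function.Bundles using (_⇔_; mk⇔; Equivalence)
open import Relation.Binary using (Rel; Asymmetric; tri<; tri≈; tri>)
open import Relation.Binary.PropositionalEquality using (_≡_; _≢_; refl; sym; trans; cong; subst)
open import Relation.Nullary using (¬_; Dec; yes; no; contradiction)
open import Relation.Nullary.Decidable using (¬?; _×-dec_; decidable-stable)
import Relation.Nullary.Decidable as Dec

private
  variable
    n : ℕ
    x i j : Fin n
    p q F G H : Subset n

x∈p─q⇒x∉q : ∀ p q → x ∈ p ─ q → x ∉ q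
x∈p─q⇒x∉q (_ ∷ p) (_ ∷ q) (there x∈p─q) (there x∈q) = x∈p─q⇒x∉q p q x∈p─q x∈q
x∈p─q⇒x∉q (_ ∷ p) (inside ∷ q) () here

p⊆q⊎∃x∈p∧x∉q : ∀ (p q : Subset n) → p ⊆ q ⊎ ∃ λ x → x ∈ p × x ∉ q
p⊆q⊎∃x∈p∧x∉q p q with any? (λ x → x ∈? p ×-dec ¬? (x ∈? q))
... | yes outlier = inj₂ outlier
... | no ∄outlier =
  inj₁ λ {x} x∈p → decidable-stable (x ∈? q) (λ x∉q → ∄outlier (x , x∈p , x∉q))

p⊆q∧∣q∣≤∣p∣⇒q≡p : ∀ {p q : Subset n} → p ⊆ q → ∣ q ∣ ≤ ∣ p ∣ → q ≡ p
p⊆q∧∣q∣≤∣p∣⇒q≡p {p = p} {q} p⊆q ∣q∣≤∣p∣ with p⊆q⊎∃x∈p∧x∉q q p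
... | inj₁ q⊆p = ⊆-antisym q⊆p p⊆q
... | inj₂ (x , x∈q , x∉p) =
  contradiction ∣q∣≤∣p∣ (<⇒≱ (p⊂q⇒∣p∣<∣q∣ (p⊆q , x , x∈q , x∉p)))

─-antitoneʳ : ∀ {p q r : Subset n} → q ⊆ r → p ─ r ⊆ p ─ q
─-antitoneʳ {p = p} {r = r} q⊆r x∈p─r =
  x∈p∧x∉q⇒x∈p─q (p─q⊆p p r x∈p─r) (x∈p─q⇒x∉q p r x∈p─r ∘ q⊆r)

x∉p⇒∣p∪⁅x⁆∣≡1+∣p∣ : ∀ p (x : Fin n) → x ∉ p → ∣ p ∪ ⁅ x ⁆ ∣ ≡ suc ∣ p ∣
x∉p⇒∣p∪⁅x⁆∣≡1+∣p∣ (outside ∷ p) zero    _   = cong (suc ∘ ∣_∣) (∪-identityʳ p)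
x∉p⇒∣p∪⁅x⁆∣≡1+∣p∣ (inside ∷ p)  zero    x∉p = contradiction here x∉p
x∉p⇒∣p∪⁅x⁆∣≡1+∣p∣ (outside ∷ p) (suc x) x∉p = x∉p⇒∣p∪⁅x⁆∣≡1+∣p∣ p x (x∉p ∘ there)
x∉p⇒∣p∪⁅x⁆∣≡1+∣p∣ (inside ∷ p)  (suc x) x∉p = cong suc (x∉p⇒∣p∪⁅x⁆∣≡1+∣p∣ p x (x∉p ∘ there))

x∉p⇒∣p∣<n : ∀ {x : Fin n} {p} → x ∉ p → ∣ p ∣ < n
x∉p⇒∣p∣<n {x = x} {p} x∉p = subst (_≤ _) (x∉p⇒∣p∪⁅x⁆∣≡1+∣p∣ p x x∉p) (∣p∣≤n (p ∪ ⁅ x ⁆))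

p∪⁅x⁆⊆q : ∀ {p q} {x : Fin n} → p ⊆ q → x ∈ q → p ∪ ⁅ x ⁆ ⊆ q
p∪⁅x⁆⊆q {p = p} {q} {x} p⊆q x∈q y∈ with x∈p∪q⁻ p ⁅ x ⁆ y∈
... | inj₁ y∈p   = p⊆q y∈p
... | inj₂ y∈⁅x⁆ = subst (_∈ q) (sym (x∈⁅y⁆⇒x≡y x y∈⁅x⁆)) x∈q

x∈p⇒1+∣p-x∣≡∣p∣ : ∀ p (x : Fin n) → x ∈ p → suc ∣ p - x ∣ ≡ ∣ p ∣
x∈p⇒1+∣p-x∣≡∣p∣ (inside ∷ p)  zero    here        = cong (suc ∘ ∣_∣) (p─⊥≡p p)
x∈p⇒1+∣p-x∣≡∣p∣ (outside ∷ p) (suc x) (there x∈p) = x∈p⇒1+∣p-x∣≡∣p∣ p x x∈p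
x∈p⇒1+∣p-x∣≡∣p∣ (inside ∷ p)  (suc x) (there x∈p) = cong suc (x∈p⇒1+∣p-x∣≡∣p∣ p x x∈p)

exchange : Subset n → Fin n → Fin n → Subset n
exchange F i j = (F - i) ∪ ⁅ j ⁆

x∈exchange⁻ : x ∈ exchange F i j → (x ∈ F × x ≢ i) ⊎ x ≡ j
x∈exchange⁻ {F = F} {i} {j} x∈ with x∈p∪q⁻ (F - i) ⁅ j ⁆ x∈
... | inj₁ x∈F-i = inj₁ (p─q⊆p F ⁅ i ⁆ x∈F-i , x∉⁅y⁆⇒x≢y (x∈p─q⇒x∉q F ⁅ i ⁆ x∈F-i))
... | inj₂ x∈⁅j⁆ = inj₂ (x∈⁅y⁆⇒x≡y j x∈⁅j⁆)

x∈exchange⁺ : x ∈ F → x ≢ i → x ∈ exchange F i j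
x∈exchange⁺ {j = j} x∈F x≢i = p⊆p∪q ⁅ j ⁆ (x∈p∧x≢y⇒x∈p-y x∈F x≢i)

j∈exchange : ∀ (F : Subset n) i j → j ∈ exchange F i j
j∈exchange F i j = q⊆p∪q (F - i) ⁅ j ⁆ (x∈⁅x⁆ j)

∣exchange∣ : i ∈ F → j ∉ F → ∣ exchange F i j ∣ ≡ ∣ F ∣
∣exchange∣ {i = i} {F} {j} i∈F j∉F =
  trans (x∉p⇒∣p∪⁅x⁆∣≡1+∣p∣ (F - i) j (j∉F ∘ p─q⊆p F ⁅ i ⁆)) (x∈p⇒1+∣p-x∣≡∣p∣ F i i∈F)

F─exchange≡⁅i⁆ : i ∈ F → j ∉ F → F ─ exchange F i j ≡ ⁅ i ⁆
F─exchange≡⁅i⁆ {i = i} {F} {j} i∈F j∉F = ⊆-antisym ⊆⁅i⁆ ⁅i⁆⊆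
  where
  ⊆⁅i⁆ : F ─ exchange F i j ⊆ ⁅ i ⁆
  ⊆⁅i⁆ {x} x∈ with x ≟ i
  ... | yes refl = x∈⁅x⁆ i
  ... | no x≢i   = contradiction (x∈exchange⁺ (p─q⊆p F _ x∈) x≢i) (x∈p─q⇒x∉q F _ x∈)
  i∉exchange : i ∉ exchange F i j
  i∉exchange i∈ with x∈exchange⁻ i∈
  ... | inj₁ (_ , i≢i) = i≢i refl
  ... | inj₂ refl      = j∉F i∈F
  ⁅i⁆⊆ : ⁅ i ⁆ ⊆ F ─ exchange F i j
  ⁅i⁆⊆ x∈⁅i⁆ rewrite x∈⁅y⁆⇒x≡y i x∈⁅i⁆ = x∈p∧x∉q⇒x∈p─q i∈F i∉exchange

exchange─F⊆⁅j⁆ : exchange F i j ─ F ⊆ ⁅ j ⁆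
exchange─F⊆⁅j⁆ {F = F} {i} {j} x∈ with x∈exchange⁻ (p─q⊆p _ F x∈)
... | inj₁ (x∈F , _) = contradiction x∈F (x∈p─q⇒x∉q _ F x∈)
... | inj₂ refl      = x∈⁅x⁆ j

─exchange⊂─ : i ∉ F → j ∈ F → j ∉ G → F ─ exchange G i j ⊂ F ─ G
─exchange⊂─ {i = i} {F} {j} {G} i∉F j∈F j∉G =
  ⊆─ , j , x∈p∧x∉q⇒x∈p─q j∈F j∉G , λ j∈ → x∈p─q⇒x∉q F _ j∈ (j∈exchange G i j)
  where
  ⊆─ : F ─ exchange G i j ⊆ F ─ G
  ⊆─ {x} x∈ = x∈p∧x∉q⇒x∈p─q x∈F x∉G
    where
    x∈F : x ∈ F
    x∈F = p─q⊆p F _ x∈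
    x∉G : x ∉ G
    x∉G x∈G = x∈p─q⇒x∉q F _ x∈ (x∈exchange⁺ x∈G λ { refl → i∉F x∈F })

infix 4 _<ₗₑₓ_

_<ₗₑₓ_ : Rel (Subset n) _
_<ₗₑₓ_ = Lex-< _≡_ Bool._<_

<ₗₑₓ-asym : Asymmetric (_<ₗₑₓ_ {n})
<ₗₑₓ-asym = Lex.<-asym sym Bool.<-resp₂-≡ Bool.<-asym

-- x is the first position where p and q differ; any y ∈ p ∖ q comes after x,
-- so exchanging x for y in q lowers q.
<ₗₑₓ⇒exchange-lowers : p <ₗₑₓ q →
  ∃ λ x → x ∈ q × x ∉ p × (∀ y → y ∈ p → y ∉ q → exchange q x y <ₗₑₓ q)
<ₗₑₓ⇒exchange-lowers (this Bool.f<t refl) = zero , here , (λ ()) , lowers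
  where
  lowers : ∀ {p q : Subset n} y → y ∈ outside ∷ p → y ∉ inside ∷ q →
           exchange (inside ∷ q) zero y <ₗₑₓ inside ∷ q
  lowers (suc y) _ _ = this Bool.f<t refl
<ₗₑₓ⇒exchange-lowers {p = s ∷ p} {q = s ∷ q} (next refl p<q)
  with <ₗₑₓ⇒exchange-lowers p<q
... | x , x∈q , x∉p , lowers = suc x , there x∈q , x∉p ∘ drop-there , lowers′ s
  where
  lowers′ : ∀ s y → y ∈ s ∷ p → y ∉ s ∷ q → exchange (s ∷ q) (suc x) y <ₗₑₓ s ∷ q
  lowers′ inside  zero    _             y∉q = contradiction here y∉q
  lowers′ outside (suc y) (there y∈p) y∉q = next refl (lowers y y∈p (y∉q ∘ there))
  lowers′ inside  (suc y) (there y∈p) y∉q = next refl (lowers y y∈p (y∉q ∘ there))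

subsets : ∀ n → List (Subset n)
subsets zero    = [ [] ]
subsets (suc n) = map (outside ∷_) (subsets n) ++ map (inside ∷_) (subsets n)

∈-subsets : ∀ (p : Subset n) → p ∈ₗ subsets n
∈-subsets []                    = here refl
∈-subsets {suc n} (outside ∷ p) = ∈-++⁺ˡ (∈-map⁺ (outside ∷_) (∈-subsets p))
∈-subsets {suc n} (inside ∷ p)  =
  ∈-++⁺ʳ (map (outside ∷_) (subsets n)) (∈-map⁺ (inside ∷_) (∈-subsets p))

subsets-sorted : ∀ n → AllPairs _<ₗₑₓ_ (subsets n)
subsets-sorted zero    = [] ∷ []
subsets-sorted (suc n) =
  AllPairs.++⁺ (AllPairs.map⁺ (AllPairs-map (next refl) (subsets-sorted n)))
               (AllPairs.map⁺ (AllPairs-map (next refl) (subsets-sorted n)))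
               (All.map⁺ (universal (λ _ → All.map⁺ (universal (λ _ → this Bool.f<t refl) _)) _))

module _ {a r} {A : Set a} {R : Rel A r} where

  AllPairs-lookup : ∀ {xs : List A} → AllPairs R xs → ∀ {i j : Fin (length xs)} →
                    toℕ i < toℕ j → R (lookup xs i) (lookup xs j)
  AllPairs-lookup (Rx ∷ _)  {zero}  {suc j} _       = All-lookup Rx (∈-lookup j)
  AllPairs-lookup (_ ∷ Rxs) {suc i} {suc j} (s≤s i<j) = AllPairs-lookup Rxs i<j

  AllPairs-lookup⁻ : Asymmetric R → ∀ {xs : List A} → AllPairs R xs → ∀ {i j : Fin (length xs)} →
                     R (lookup xs i) (lookup xs j) → toℕ i < toℕ j
  AllPairs-lookup⁻ asym sorted {i} {j} Rij with <-cmp i j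
  ... | tri< i<j _ _ = i<j
  ... | tri≈ _ refl _ = contradiction Rij (asym Rij)
  ... | tri> _ _ j<i = contradiction (AllPairs-lookup sorted j<i) (asym Rij)

module _ (Δ : SimplicialComplex n) where

  Extendable : Subset n → Set
  Extendable F = ∃ λ x → x ∉ F × face Δ (F ∪ ⁅ x ⁆)

  extendable? : ∀ F → Dec (Extendable F)
  extendable? F = any? (λ x → ¬? (x ∈? F) ×-dec decide Δ (F ∪ ⁅ x ⁆))

  isFacet⇔unextendable : IsFacet Δ F ⇔ (face Δ F × ¬ Extendable F)
  isFacet⇔unextendable {F = F} = mk⇔ (λ (faceF , maximal) → faceF , unextendable maximal)
                                     (λ (faceF , ¬ext) → faceF , maximal ¬ext)
    where
    unextendable : (∀ G → face Δ G → F ⊆ G → G ≡ F) → ¬ Extendable F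
    unextendable maximal (x , x∉F , faceF∪x) =
      x∉F (subst (x ∈_) (maximal _ faceF∪x (p⊆p∪q ⁅ x ⁆)) (q⊆p∪q F ⁅ x ⁆ (x∈⁅x⁆ x)))
    maximal : ¬ Extendable F → ∀ G → face Δ G → F ⊆ G → G ≡ F
    maximal ¬ext G faceG F⊆G with p⊆q⊎∃x∈p∧x∉q G F
    ... | inj₁ G⊆F = ⊆-antisym G⊆F F⊆G
    ... | inj₂ (x , x∈G , x∉F) =
      contradiction (x , x∉F , closed Δ faceG (p∪⁅x⁆⊆q F⊆G x∈G)) ¬ext

  isFacet? : ∀ F → Dec (IsFacet Δ F)
  isFacet? F = Dec.map′ (Equivalence.from isFacet⇔unextendable)
                        (Equivalence.to isFacet⇔unextendable)
                        (decide Δ F ×-dec ¬? (extendable? F))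

  -- m bounds the number of vertices that can still be added to F
  face⊆facet′ : ∀ m F → n ≤ m + ∣ F ∣ → face Δ F → ∃ λ G → IsFacet Δ G × F ⊆ G
  face⊆facet′ m F bound faceF with extendable? F
  ... | no ¬ext = F , Equivalence.from isFacet⇔unextendable (faceF , ¬ext) , id
  face⊆facet′ zero F bound faceF | yes (x , x∉F , _) = contradiction bound (<⇒≱ (x∉p⇒∣p∣<n x∉F))
  face⊆facet′ (suc m) F bound faceF | yes (x , x∉F , faceF∪x)
    with face⊆facet′ m (F ∪ ⁅ x ⁆) bound′ faceF∪x
    where
    bound′ : n ≤ m + ∣ F ∪ ⁅ x ⁆ ∣
    bound′ = begin
      n                    ≤⟨ bound ⟩
      suc (m + ∣ F ∣)      ≡⟨ +-suc m ∣ F ∣ ⟨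
      m + suc ∣ F ∣        ≡⟨ cong (m +_) (x∉p⇒∣p∪⁅x⁆∣≡1+∣p∣ F x x∉F) ⟨
      m + ∣ F ∪ ⁅ x ⁆ ∣    ∎
      where open ≤-Reasoning
  ... | G , facetG , F∪x⊆G = G , facetG , F∪x⊆G ∘ p⊆p∪q ⁅ x ⁆

  face⊆facet : face Δ F → ∃ λ G → IsFacet Δ G × F ⊆ G
  face⊆facet {F = F} = face⊆facet′ n F (m≤m+n n ∣ F ∣)

  lexFacets : List (Subset n)
  lexFacets = filter isFacet? (subsets n)

  lexFacets-sorted : AllPairs _<ₗₑₓ_ lexFacets
  lexFacets-sorted = AllPairs.filter⁺ isFacet? (subsets-sorted n)

  lexFacets-isFacetOrder : IsFacetOrder Δ lexFacets
  lexFacets-isFacetOrder =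
    AllPairs-map (λ { p<q refl → <ₗₑₓ-asym p<q p<q }) lexFacets-sorted ,
    λ F → mk⇔ (proj₂ ∘ ∈-filter⁻ isFacet? {xs = subsets n}) (∈-filter⁺ isFacet? (∈-subsets F))

-- Matroid complexes are pure

module _ {Δ : SimplicialComplex n} (matroid : IsMatroidComplex Δ) where

  facet-exchange : IsFacet Δ F → IsFacet Δ G → i ∈ F → i ∉ G →
                   ∃ λ j → j ∈ G × j ∉ F × face Δ (exchange F i j)
  facet-exchange {i = i} facetF facetG i∈F i∉G =
    matroid _ _ facetF facetG (λ { refl → i∉G i∈F }) i i∈F i∉G

  closerFacet : IsFacet Δ F → IsFacet Δ G → i ∈ G → i ∉ F →
                ∃ λ G′ → IsFacet Δ G′ × ∣ G ∣ ≤ ∣ G′ ∣ × ∣ F ─ G′ ∣ < ∣ F ─ G ∣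
  closerFacet facetF facetG i∈G i∉F with facet-exchange facetG facetF i∈G i∉F
  ... | j , j∈F , j∉G , faceGij with face⊆facet Δ faceGij
  ... | G′ , facetG′ , Gij⊆G′ =
    G′ , facetG′ ,
    subst (_≤ _) (∣exchange∣ i∈G j∉G) (p⊆q⇒∣p∣≤∣q∣ Gij⊆G′) ,
    p⊂q⇒∣p∣<∣q∣ (⊆-⊂-trans (─-antitoneʳ Gij⊆G′) (─exchange⊂─ i∉F j∈F j∉G))

  isFacet⇒∣G∣≤∣F∣′ : ∀ d {F G : Subset n} → ∣ F ─ G ∣ < d →
                     IsFacet Δ F → IsFacet Δ G → ∣ G ∣ ≤ ∣ F ∣
  isFacet⇒∣G∣≤∣F∣′ (suc d) {F} {G} bound facetF facetG with p⊆q⊎∃x∈p∧x∉q G F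
  ... | inj₁ G⊆F = p⊆q⇒∣p∣≤∣q∣ G⊆F
  ... | inj₂ (i , i∈G , i∉F) with closerFacet facetF facetG i∈G i∉F
  ... | G′ , facetG′ , ∣G∣≤∣G′∣ , closer =
    ≤-trans ∣G∣≤∣G′∣ (isFacet⇒∣G∣≤∣F∣′ d (<-≤-trans closer (≤-pred bound)) facetF facetG′)

  isFacet⇒∣G∣≤∣F∣ : IsFacet Δ F → IsFacet Δ G → ∣ G ∣ ≤ ∣ F ∣
  isFacet⇒∣G∣≤∣F∣ = isFacet⇒∣G∣≤∣F∣′ _ (n<1+n _)

  ∣F∣≤∣H∣⇒isFacet : IsFacet Δ F → face Δ H → ∣ F ∣ ≤ ∣ H ∣ → IsFacet Δ H
  ∣F∣≤∣H∣⇒isFacet facetF faceH ∣F∣≤∣H∣ = faceH , λ K faceK H⊆K →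
    let K′ , facetK′ , K⊆K′ = face⊆facet Δ faceK
    in p⊆q∧∣q∣≤∣p∣⇒q≡p H⊆K
         (≤-trans (p⊆q⇒∣p∣≤∣q∣ K⊆K′) (≤-trans (isFacet⇒∣G∣≤∣F∣ facetF facetK′) ∣F∣≤∣H∣))

  exchange-isFacet : IsFacet Δ F → i ∈ F → j ∉ F →
                     face Δ (exchange F i j) → IsFacet Δ (exchange F i j)
  exchange-isFacet facetF i∈F j∉F faceFij =
    ∣F∣≤∣H∣⇒isFacet facetF faceFij (≤-reflexive (sym (∣exchange∣ i∈F j∉F)))

StrongShellingStep : Subset n → Subset n → Subset n → Set
StrongShellingStep Fj Fi Fk = ∣ Fj ─ Fk ∣ ≡ 1 × Fj ─ Fk ⊆ Fj ─ Fi × Fk ─ Fj ⊆ Fi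

exchange-strongShellingStep : i ∈ F → i ∉ G → j ∈ G → j ∉ F →
                              StrongShellingStep F G (exchange F i j)
exchange-strongShellingStep {i = i} {F} {G} {j} i∈F i∉G j∈G j∉F =
  trans (cong ∣_∣ F─Fij≡⁅i⁆) (∣⁅x⁆∣≡1 i) ,
  (λ {x} x∈ → subst (_∈ F ─ G) (sym (x∈⁅y⁆⇒x≡y i (subst (x ∈_) F─Fij≡⁅i⁆ x∈)))
                    (x∈p∧x∉q⇒x∈p─q i∈F i∉G)) ,
  (λ x∈ → subst (_∈ G) (sym (x∈⁅y⁆⇒x≡y j (exchange─F⊆⁅j⁆ x∈))) j∈G)
  where
  F─Fij≡⁅i⁆ : F ─ exchange F i j ≡ ⁅ i ⁆
  F─Fij≡⁅i⁆ = F─exchange≡⁅i⁆ i∈F j∉F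

module _ {Δ : SimplicialComplex n} (matroid : IsMatroidComplex Δ) where

  private
    L : List (Subset n)
    L = lexFacets Δ

    lookup-isFacet : ∀ k → IsFacet Δ (lookup L k)
    lookup-isFacet k = Equivalence.to (proj₂ (lexFacets-isFacetOrder Δ) _) (∈-lookup k)

  lexFacets-strongShelling : ∀ (i j : Fin (length L)) → toℕ i < toℕ j →
    ∃ λ k → toℕ k < toℕ j × StrongShellingStep (lookup L j) (lookup L i) (lookup L k)
  lexFacets-strongShelling i j i<j
    with <ₗₑₓ⇒exchange-lowers (AllPairs-lookup (lexFacets-sorted Δ) i<j)
  ... | x , x∈Fj , x∉Fi , lowers
    with facet-exchange {Δ = Δ} matroid (lookup-isFacet j) (lookup-isFacet i) x∈Fj x∉Fi
  ... | y , y∈Fi , y∉Fj , faceFj[x↦y] =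
    index H∈L ,
    AllPairs-lookup⁻ <ₗₑₓ-asym (lexFacets-sorted Δ)
      (subst (_<ₗₑₓ lookup L j) H≡ (lowers y y∈Fi y∉Fj)) ,
    subst (StrongShellingStep (lookup L j) (lookup L i)) H≡
      (exchange-strongShellingStep x∈Fj x∉Fi y∈Fi y∉Fj)
    where
    H∈L : exchange (lookup L j) x y ∈ₗ L
    H∈L = Equivalence.from (proj₂ (lexFacets-isFacetOrder Δ) _)
            (exchange-isFacet {Δ = Δ} matroid (lookup-isFacet j) x∈Fj y∉Fj faceFj[x↦y])
    H≡ : exchange (lookup L j) x y ≡ lookup L (index H∈L)
    H≡ = lookup-index H∈L

proposition6p3 : ∀ (n : ℕ) (Δ : SimplicialComplex n) →
    IsMatroidComplex Δ → IsStronglyShellable Δ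
proposition6p3 n Δ matroid =
  lexFacets Δ , lexFacets-isFacetOrder Δ , lexFacets-strongShelling {Δ = Δ} matroid
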